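{- Let $v\equiv 6,14\pmod{20}$. Consider any decomposition of the edge set of $K_v$ into copies of $K_3$, $K_4$ and $K_5$ with exactly $\frac{v^2+5v+14}{20}$ cliques in total, of which exactly $7$ are copies of $K_3$. Then these seven triangles are pairwise vertex-disjoint.
   Context: A decomposition of the edge set of $K_v$ into cliques means a collection of complete subgraphs of $K_v$ such that every edge of $K_v$ lies in exactly one of them. -}

module Defs where

open import Data.Nat using (ℕ; _+_; _*_; _%_)
open import Data.Fin using (Fin)
open import Data.List using (List; length; lookup; filter)
open import Data.List.Membership.Propositional using (_∈_)
open import Data.List.Relation.Unary.Unique.Propositional using (Unique)
open import Data.Product using (_×_; Σ; ∃-syntax)
open import Data.Sum using (_⊎_)
open import Relation.Binary.PropositionalEquality using (_≡_; _≢_)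
import Data.Nat as ℕ

-- A clique of K_v is given by its vertex set: a duplicate-free list of vertices.
Clique : ℕ → Set
Clique v = List (Fin v)

SizeIn345 : {v : ℕ} → Clique v → Set
SizeIn345 b = length b ≡ 3 ⊎ length b ≡ 4 ⊎ length b ≡ 5

IsK345Decomposition : (v : ℕ) → List (Clique v) → Set
IsK345Decomposition v bs =
  ((i : Fin (length bs)) → Unique (lookup bs i) × SizeIn345 (lookup bs i))
  × ((x y : Fin v) → x ≢ y →
       (∃[ i ] (x ∈ lookup bs i × y ∈ lookup bs i))
       × ((i j : Fin (length bs)) →
            x ∈ lookup bs i × y ∈ lookup bs i →
            x ∈ lookup bs j × y ∈ lookup bs j → i ≡ j))

numTriangles : {v : ℕ} → List (Clique v) → ℕ
numTriangles bs = length (filter (λ b → length b ℕ.≟ 3) bs)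

-- For a point x, let r x be the number of cliques through x and
-- d x = ∑_{B ∋ x} (5 − |B|) its deficiency. The cliques through x partition
-- the other v − 1 points, so d x = 4 r x − (v − 1) ≡ 3 (mod 4) because
-- v ≡ 2 (mod 4); hence d x ≥ 3 everywhere. Double counting gives
-- ∑ₓ d x = ∑_B (5 − |B|)|B|, and the identity 2(5 − s)s + s² + 2[s = 3] = 20 + s
-- (s = 3, 4, 5) together with ∑_B |B|(|B| − 1) = v(v − 1), the prescribed
-- number of cliques and the seven triangles yields ∑ₓ d x = 3v. So d x = 3 at
-- every point, whereas a point on two triangles has deficiency at least 4.

module Submission where

open import Defs
import Algebra.Properties.Semiring.Sum as SemiringSum
open import Data.Empty using (⊥-elim)
open import Data.Fin using (Fin; zero; suc)
open import Data.Fin.Properties using (_≟_; suc-injective)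
open import Data.List using (List; []; _∷_; length; lookup; filter)
open import Data.List.Membership.Propositional using (_∈_; _∉_)
import Data.List.Membership.DecPropositional as DecMembership
open import Data.List.Relation.Unary.All.Properties using (All¬⇒¬Any)
open import Data.List.Relation.Unary.Any using (here; there)
open import Data.List.Relation.Unary.AllPairs using (_∷_)
open import Data.List.Relation.Unary.Unique.Propositional using (Unique)
open import Data.Nat using (ℕ; zero; suc; _+_; _*_; _∸_; _%_; _/_; _≤_; z≤n; s≤s; pred)
import Data.Nat as ℕ
open import Data.Nat.DivMod using (m≡m%n+[m/n]*n)
open import Data.Nat.Properties
  using (+-*-semiring; +-comm; +-suc; +-identityʳ; *-comm; *-identityʳ; *-distribˡ-+;
         *-cancelˡ-≡; +-cancelʳ-≡; +-cancelˡ-≤; +-cancelʳ-≤; +-mono-≤; +-monoʳ-≤;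
         ≤-antisym; ≤-trans; ≤-refl; m≤m+n; m≤n+m; m∸n+n≡m; <-irrefl)
open import Data.Nat.Tactic.RingSolver using (solve-∀)
open import Data.Product using (_×_; _,_; proj₁; proj₂; ∃-syntax)
open import Data.Sum using (_⊎_; inj₁; inj₂)
open import Function using (_∘_)
open import Relation.Nullary using (Dec; yes; no; ¬_)
open import Relation.Unary using (Pred; Decidable)
open import Relation.Binary.PropositionalEquality
  using (_≡_; _≢_; refl; sym; trans; cong; cong₂; subst; module ≡-Reasoning)

open SemiringSum +-*-semiring
  using (sum; sum-syntax; sum-cong-≗; sum-replicate-zero; ∑-distrib-+; ∑-comm;
         *-distribˡ-sum; *-distribʳ-sum)
open ≡-Reasoning

∑-const : ∀ n c → ∑[ i < n ] c ≡ n * c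
∑-const zero    c = refl
∑-const (suc n) c = cong (c +_) (∑-const n c)

∑-vanishing : ∀ {n} (f : Fin n → ℕ) → (∀ i → f i ≡ 0) → sum f ≡ 0
∑-vanishing {n} f f≡0 = trans (sum-cong-≗ f≡0) (sum-replicate-zero n)

∑-supported-at : ∀ {n} (f : Fin n → ℕ) i → (∀ j → j ≢ i → f j ≡ 0) → sum f ≡ f i
∑-supported-at f zero    off =
  trans (cong (f zero +_) (∑-vanishing (f ∘ suc) (λ j → off (suc j) λ ()))) (+-identityʳ (f zero))
∑-supported-at f (suc i) off rewrite off zero (λ ()) =
  ∑-supported-at (f ∘ suc) i (λ j j≢i → off (suc j) (j≢i ∘ suc-injective))

∑-ones-off : ∀ {n} (f : Fin n → ℕ) i → (∀ j → j ≢ i → f j ≡ 1) → sum f + 1 ≡ f i + n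
∑-ones-off {suc n} f zero off = begin
  f zero + sum (f ∘ suc) + 1  ≡⟨ cong (λ s → f zero + s + 1) (sum-cong-≗ (λ j → off (suc j) λ ())) ⟩
  f zero + ∑[ j < n ] 1 + 1   ≡⟨ cong (λ s → f zero + s + 1) (∑-const n 1) ⟩
  f zero + n * 1 + 1          ≡⟨ regroup (f zero) n ⟩
  f zero + suc n              ∎
  where
  regroup : ∀ a n → a + n * 1 + 1 ≡ a + (1 + n)
  regroup = solve-∀
∑-ones-off {suc n} f (suc i) off rewrite off zero (λ ()) =
  trans (cong suc (∑-ones-off (f ∘ suc) i (λ j j≢i → off (suc j) (j≢i ∘ suc-injective))))
        (sym (+-suc (f (suc i)) n))

∑-≥-term : ∀ {n} (f : Fin n → ℕ) i → f i ≤ sum f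
∑-≥-term f zero    = m≤m+n (f zero) _
∑-≥-term f (suc i) = ≤-trans (∑-≥-term (f ∘ suc) i) (m≤n+m _ (f zero))

∑-≥-pair : ∀ {n} (f : Fin n → ℕ) i j → i ≢ j → f i + f j ≤ sum f
∑-≥-pair f zero    zero    i≢j = ⊥-elim (i≢j refl)
∑-≥-pair f zero    (suc j) i≢j = +-monoʳ-≤ (f zero) (∑-≥-term (f ∘ suc) j)
∑-≥-pair f (suc i) zero    i≢j =
  subst (_≤ sum f) (+-comm (f zero) (f (suc i))) (+-monoʳ-≤ (f zero) (∑-≥-term (f ∘ suc) i))
∑-≥-pair f (suc i) (suc j) i≢j =
  ≤-trans (∑-≥-pair (f ∘ suc) i j (i≢j ∘ cong suc)) (m≤n+m _ (f zero))

∑-≥ : ∀ {n} (f : Fin n → ℕ) c → (∀ i → c ≤ f i) → n * c ≤ sum f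
∑-≥ {zero}  f c c≤f = z≤n
∑-≥ {suc n} f c c≤f = +-mono-≤ (c≤f zero) (∑-≥ (f ∘ suc) c (c≤f ∘ suc))

∑-≡-lower-bound⇒const : ∀ {n} (f : Fin n → ℕ) c → (∀ i → c ≤ f i) → sum f ≡ n * c →
                         ∀ i → f i ≡ c
∑-≡-lower-bound⇒const {suc n} f c c≤f ∑f≡ = pointwise
  where
  ∑tail≥ : n * c ≤ sum (f ∘ suc)
  ∑tail≥ = ∑-≥ (f ∘ suc) c (c≤f ∘ suc)
  pointwise : ∀ i → f i ≡ c
  pointwise zero = ≤-antisym
    (+-cancelʳ-≤ (sum (f ∘ suc)) (f zero) c
      (subst (_≤ c + sum (f ∘ suc)) (sym ∑f≡) (+-monoʳ-≤ c ∑tail≥)))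
    (c≤f zero)
  pointwise (suc i) = ∑-≡-lower-bound⇒const (f ∘ suc) c (c≤f ∘ suc) ∑tail≡ i
    where
    ∑tail≡ : sum (f ∘ suc) ≡ n * c
    ∑tail≡ = ≤-antisym
      (+-cancelˡ-≤ c (sum (f ∘ suc)) (n * c)
        (subst (c + sum (f ∘ suc) ≤_) ∑f≡ (+-mono-≤ (c≤f zero) (≤-refl {sum (f ∘ suc)}))))
      ∑tail≥

χ : ∀ {p} {P : Set p} → Dec P → ℕ
χ (yes _) = 1
χ (no _)  = 0

χ-yes : ∀ {p} {P : Set p} (P? : Dec P) → P → χ P? ≡ 1
χ-yes (yes _) _ = refl
χ-yes (no ¬p) p = ⊥-elim (¬p p)

χ-no : ∀ {p} {P : Set p} (P? : Dec P) → ¬ P → χ P? ≡ 0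
χ-no (yes p) ¬p = ⊥-elim (¬p p)
χ-no (no _)  _  = refl

χ*χ≡χ : ∀ {p} {P : Set p} (P? : Dec P) → χ P? * χ P? ≡ χ P?
χ*χ≡χ (yes _) = refl
χ*χ≡χ (no _)  = refl

χ*χ≡0 : ∀ {p q} {P : Set p} {Q : Set q} (P? : Dec P) (Q? : Dec Q) →
        ¬ (P × Q) → χ P? * χ Q? ≡ 0
χ*χ≡0 (yes p) (yes q) ¬p×q = ⊥-elim (¬p×q (p , q))
χ*χ≡0 (yes _) (no _)  _    = refl
χ*χ≡0 (no _)  _       _    = refl

length-filter≡∑χ : ∀ {a p} {A : Set a} {P : Pred A p} (P? : Decidable P) (xs : List A) →
                   length (filter P? xs) ≡ ∑[ i < length xs ] χ (P? (lookup xs i))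
length-filter≡∑χ P? []       = refl
length-filter≡∑χ P? (x ∷ xs) with P? x
... | yes _ = cong suc (length-filter≡∑χ P? xs)
... | no _  = length-filter≡∑χ P? xs

module _ {v : ℕ} where
  open DecMembership (_≟_ {v}) using (_∈?_)

  ∑-χ-≡ : ∀ a → ∑[ y < v ] χ (y ≟ a) ≡ 1
  ∑-χ-≡ a = trans (∑-supported-at _ a (λ y y≢a → χ-no (y ≟ a) y≢a)) (χ-yes (a ≟ a) refl)

  χ-∈-∷ : ∀ y a (b : List (Fin v)) → a ∉ b → χ (y ∈? a ∷ b) ≡ χ (y ≟ a) + χ (y ∈? b)
  χ-∈-∷ y a b a∉b = split (y ≟ a) (y ∈? b)
    where
    split : (y≟a : Dec (y ≡ a)) (y∈?b : Dec (y ∈ b)) → χ (y ∈? a ∷ b) ≡ χ y≟a + χ y∈?b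
    split (yes refl) y∈?b      =
      trans (χ-yes (y ∈? a ∷ b) (here refl)) (cong suc (sym (χ-no y∈?b a∉b)))
    split (no y≢a)   (yes y∈b) = χ-yes (y ∈? a ∷ b) (there y∈b)
    split (no y≢a)   (no y∉b)  =
      χ-no (y ∈? a ∷ b) λ { (here y≡a) → y≢a y≡a ; (there y∈b) → y∉b y∈b }

  ∑-χ-∈≡length : (b : List (Fin v)) → Unique b → ∑[ y < v ] χ (y ∈? b) ≡ length b
  ∑-χ-∈≡length []      _           = ∑-vanishing _ (λ y → χ-no (y ∈? []) λ ())
  ∑-χ-∈≡length (a ∷ b) (a∉b ∷ b!) = begin
    ∑[ y < v ] χ (y ∈? a ∷ b)
      ≡⟨ sum-cong-≗ (λ y → χ-∈-∷ y a b (All¬⇒¬Any a∉b)) ⟩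
    ∑[ y < v ] (χ (y ≟ a) + χ (y ∈? b))
      ≡⟨ ∑-distrib-+ (λ y → χ (y ≟ a)) (λ y → χ (y ∈? b)) ⟩
    ∑[ y < v ] χ (y ≟ a) + ∑[ y < v ] χ (y ∈? b)
      ≡⟨ cong₂ _+_ (∑-χ-≡ a) (∑-χ-∈≡length b b!) ⟩
    1 + length b
      ∎

PairsCoveredOnce : {v : ℕ} → List (Clique v) → Set
PairsCoveredOnce {v} bs = (x y : Fin v) → x ≢ y →
  (∃[ i ] (x ∈ lookup bs i × y ∈ lookup bs i))
  × ((i j : Fin (length bs)) →
       x ∈ lookup bs i × y ∈ lookup bs i → x ∈ lookup bs j × y ∈ lookup bs j → i ≡ j)

module CliqueDecomposition {v : ℕ} (bs : List (Clique v))
  (unique : ∀ i → Unique (lookup bs i)) (covered-once : PairsCoveredOnce bs) where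

  open DecMembership (_≟_ {v}) using (_∈?_)

  n : ℕ
  n = length bs

  block : Fin n → Clique v
  block = lookup bs

  size : Fin n → ℕ
  size i = length (block i)

  incidence : Fin n → Fin v → ℕ
  incidence i x = χ (x ∈? block i)

  replication : Fin v → ℕ
  replication x = ∑[ i < n ] incidence i x

  ∑-incidence-block : ∀ i → ∑[ x < v ] incidence i x ≡ size i
  ∑-incidence-block i = ∑-χ-∈≡length (block i) (unique i)

  ∑-incidence-pair : ∀ x y → x ≢ y → ∑[ i < n ] (incidence i x * incidence i y) ≡ 1
  ∑-incidence-pair x y x≢y with covered-once x y x≢y
  ... | (i , x∈Bi , y∈Bi) , once = begin
    ∑[ j < n ] (incidence j x * incidence j y)
      ≡⟨ ∑-supported-at _ i off-i ⟩
    incidence i x * incidence i y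
      ≡⟨ cong₂ _*_ (χ-yes (x ∈? block i) x∈Bi) (χ-yes (y ∈? block i) y∈Bi) ⟩
    1
      ∎
    where
    off-i : ∀ j → j ≢ i → incidence j x * incidence j y ≡ 0
    off-i j j≢i = χ*χ≡0 (x ∈? block j) (y ∈? block j)
                        (λ x,y∈Bj → j≢i (once j i x,y∈Bj (x∈Bi , y∈Bi)))

  double-counting : (g : Fin n → ℕ) →
                    ∑[ x < v ] ∑[ i < n ] (incidence i x * g i) ≡ ∑[ i < n ] (g i * size i)
  double-counting g = begin
    ∑[ x < v ] ∑[ i < n ] (incidence i x * g i)
      ≡⟨ ∑-comm (λ i x → incidence i x * g i) ⟨
    ∑[ i < n ] ∑[ x < v ] (incidence i x * g i)
      ≡⟨ sum-cong-≗ (λ i → *-distribʳ-sum (g i) (incidence i)) ⟨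
    ∑[ i < n ] ((∑[ x < v ] incidence i x) * g i)
      ≡⟨ sum-cong-≗ (λ i → cong (_* g i) (∑-incidence-block i)) ⟩
    ∑[ i < n ] (size i * g i)
      ≡⟨ sum-cong-≗ (λ i → *-comm (size i) (g i)) ⟩
    ∑[ i < n ] (g i * size i)
      ∎

  ∑-replication : ∑[ x < v ] replication x ≡ ∑[ i < n ] size i
  ∑-replication = trans (sym (∑-comm (λ i x → incidence i x))) (sum-cong-≗ ∑-incidence-block)

  -- The cliques through x partition the v − 1 points other than x.
  ∑-size-through : ∀ x → ∑[ i < n ] (incidence i x * size i) + 1 ≡ replication x + v
  ∑-size-through x = begin
    ∑[ i < n ] (incidence i x * size i) + 1
      ≡⟨ cong (_+ 1) (sum-cong-≗ expand) ⟩
    ∑[ i < n ] ∑[ y < v ] (incidence i x * incidence i y) + 1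
      ≡⟨ cong (_+ 1) (∑-comm (λ i y → incidence i x * incidence i y)) ⟩
    ∑[ y < v ] ∑[ i < n ] (incidence i x * incidence i y) + 1
      ≡⟨ ∑-ones-off _ x (λ y y≢x → ∑-incidence-pair x y (y≢x ∘ sym)) ⟩
    ∑[ i < n ] (incidence i x * incidence i x) + v
      ≡⟨ cong (_+ v) (sum-cong-≗ (λ i → χ*χ≡χ (x ∈? block i))) ⟩
    replication x + v
      ∎
    where
    expand : ∀ i → incidence i x * size i ≡ ∑[ y < v ] (incidence i x * incidence i y)
    expand i = trans (cong (incidence i x *_) (sym (∑-incidence-block i)))
                     (*-distribˡ-sum (incidence i x) (incidence i))

  ∑-size² : ∑[ i < n ] (size i * size i) + v ≡ ∑[ i < n ] size i + v * v
  ∑-size² = begin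
    ∑[ i < n ] (size i * size i) + v
      ≡⟨ cong₂ _+_ (double-counting size) ∑-ones ⟨
    ∑[ x < v ] ∑[ i < n ] (incidence i x * size i) + ∑[ x < v ] 1
      ≡⟨ ∑-distrib-+ (λ x → ∑[ i < n ] (incidence i x * size i)) (λ _ → 1) ⟨
    ∑[ x < v ] (∑[ i < n ] (incidence i x * size i) + 1)
      ≡⟨ sum-cong-≗ ∑-size-through ⟩
    ∑[ x < v ] (replication x + v)
      ≡⟨ ∑-distrib-+ replication (λ _ → v) ⟩
    ∑[ x < v ] replication x + ∑[ x < v ] v
      ≡⟨ cong₂ _+_ ∑-replication (∑-const v v) ⟩
    ∑[ i < n ] size i + v * v
      ∎
    where
    ∑-ones : ∑[ x < v ] 1 ≡ v
    ∑-ones = trans (∑-const v 1) (*-identityʳ v)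

≡6∨14-mod-20⇒≡2-mod-4 : ∀ v → v % 20 ≡ 6 ⊎ v % 20 ≡ 14 → ∃[ k ] v ≡ k * 4 + 2
≡6∨14-mod-20⇒≡2-mod-4 v (inj₁ v%20≡6) = v / 20 * 5 + 1 ,
  trans (m≡m%n+[m/n]*n v 20) (trans (cong (_+ v / 20 * 20) v%20≡6) (expand (v / 20)))
  where
  expand : ∀ q → 6 + q * 20 ≡ (q * 5 + 1) * 4 + 2
  expand = solve-∀
≡6∨14-mod-20⇒≡2-mod-4 v (inj₂ v%20≡14) = v / 20 * 5 + 3 ,
  trans (m≡m%n+[m/n]*n v 20) (trans (cong (_+ v / 20 * 20) v%20≡14) (expand (v / 20)))
  where
  expand : ∀ q → 14 + q * 20 ≡ (q * 5 + 3) * 4 + 2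
  expand = solve-∀

≡3-mod-4⇒≥3 : ∀ k r d → k * 4 + 2 + d ≡ r * 4 + 1 → 3 ≤ d
≡3-mod-4⇒≥3 zero    zero    d ()
≡3-mod-4⇒≥3 (suc k) zero    d ()
≡3-mod-4⇒≥3 zero    (suc r) d eq =
  subst (3 ≤_) (sym (cong (pred ∘ pred) eq)) (s≤s (s≤s (m≤n+m 1 (r * 4))))
≡3-mod-4⇒≥3 (suc k) (suc r) d eq = ≡3-mod-4⇒≥3 k r d (cong (pred ∘ pred ∘ pred ∘ pred) eq)

In345 : ℕ → Set
In345 s = s ≡ 3 ⊎ s ≡ 4 ⊎ s ≡ 5

In345⇒≤5 : ∀ {s} → In345 s → s ≤ 5
In345⇒≤5 (inj₁ refl)        = m≤m+n 3 2
In345⇒≤5 (inj₂ (inj₁ refl)) = m≤m+n 4 1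
In345⇒≤5 (inj₂ (inj₂ refl)) = m≤m+n 5 0

In345-identity : ∀ {s} → In345 s → 2 * ((5 ∸ s) * s) + s * s + 2 * χ (s ℕ.≟ 3) ≡ 20 + s
In345-identity (inj₁ refl)        = refl
In345-identity (inj₂ (inj₁ refl)) = refl
In345-identity (inj₂ (inj₂ refl)) = refl

regroup-deficiency : ∀ d a r v → d + a ≡ r * 5 → a + 1 ≡ r + v → d + v ≡ r * 4 + 1
regroup-deficiency d a r v d+a≡ a+1≡ = +-cancelʳ-≡ (a + 1) (d + v) (r * 4 + 1) (begin
  d + v + (a + 1)      ≡⟨ swap d v a ⟩
  d + a + (v + 1)      ≡⟨ cong (_+ (v + 1)) d+a≡ ⟩
  r * 5 + (v + 1)      ≡⟨ split r v ⟩
  r * 4 + 1 + (r + v)  ≡⟨ cong (r * 4 + 1 +_) a+1≡ ⟨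
  r * 4 + 1 + (a + 1)  ∎)
  where
  swap : ∀ d v a → d + v + (a + 1) ≡ d + a + (v + 1)
  swap = solve-∀
  split : ∀ r v → r * 5 + (v + 1) ≡ r * 4 + 1 + (r + v)
  split = solve-∀

total-deficiency : ∀ F Q S n v → 2 * F + Q + 2 * 7 ≡ 20 * n + S → Q + v ≡ S + v * v →
                   20 * n ≡ v * v + 5 * v + 14 → F ≡ v * 3
total-deficiency F Q S n v count squares clique-count =
  *-cancelˡ-≡ F (v * 3) 2 (+-cancelʳ-≡ (S + v * v + 14) (2 * F) (2 * (v * 3)) (begin
    2 * F + (S + v * v + 14)    ≡⟨ cong (λ t → 2 * F + (t + 14)) squares ⟨
    2 * F + (Q + v + 14)        ≡⟨ regroup F Q v ⟩
    2 * F + Q + 2 * 7 + v       ≡⟨ cong (_+ v) count ⟩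
    20 * n + S + v              ≡⟨ cong (λ t → t + S + v) clique-count ⟩
    v * v + 5 * v + 14 + S + v  ≡⟨ collect S v ⟩
    2 * (v * 3) + (S + v * v + 14) ∎))
  where
  regroup : ∀ F Q v → 2 * F + (Q + v + 14) ≡ 2 * F + Q + 2 * 7 + v
  regroup = solve-∀
  collect : ∀ S v → v * v + 5 * v + 14 + S + v ≡ 2 * (v * 3) + (S + v * v + 14)
  collect = solve-∀

module K345Decomposition {v : ℕ} (bs : List (Clique v)) (dec : IsK345Decomposition v bs) where

  open CliqueDecomposition bs (proj₁ ∘ proj₁ dec) (proj₂ dec) public
  open DecMembership (_≟_ {v}) using (_∈?_)

  size-345 : ∀ i → In345 (size i)
  size-345 = proj₂ ∘ proj₁ dec

  deficiency : Fin v → ℕ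
  deficiency x = ∑[ i < n ] (incidence i x * (5 ∸ size i))

  deficiency+∑size : ∀ x → deficiency x + ∑[ i < n ] (incidence i x * size i) ≡ replication x * 5
  deficiency+∑size x = begin
    deficiency x + ∑[ i < n ] (incidence i x * size i)
      ≡⟨ ∑-distrib-+ (λ i → incidence i x * (5 ∸ size i)) (λ i → incidence i x * size i) ⟨
    ∑[ i < n ] (incidence i x * (5 ∸ size i) + incidence i x * size i)
      ≡⟨ sum-cong-≗ fill-to-5 ⟩
    ∑[ i < n ] (incidence i x * 5)
      ≡⟨ *-distribʳ-sum 5 (λ i → incidence i x) ⟨
    replication x * 5
      ∎
    where
    fill-to-5 : ∀ i → incidence i x * (5 ∸ size i) + incidence i x * size i ≡ incidence i x * 5
    fill-to-5 i = trans (sym (*-distribˡ-+ (incidence i x) (5 ∸ size i) (size i)))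
                        (cong (incidence i x *_) (m∸n+n≡m (In345⇒≤5 (size-345 i))))

  deficiency+v : ∀ x → deficiency x + v ≡ replication x * 4 + 1
  deficiency+v x = regroup-deficiency (deficiency x) _ (replication x) v
                     (deficiency+∑size x) (∑-size-through x)

  deficiency≥3 : ∀ k → v ≡ k * 4 + 2 → ∀ x → 3 ≤ deficiency x
  deficiency≥3 k v≡ x = ≡3-mod-4⇒≥3 k (replication x) (deficiency x) (begin
    k * 4 + 2 + deficiency x    ≡⟨ +-comm (k * 4 + 2) (deficiency x) ⟩
    deficiency x + (k * 4 + 2)  ≡⟨ cong (deficiency x +_) v≡ ⟨
    deficiency x + v            ≡⟨ deficiency+v x ⟩
    replication x * 4 + 1       ∎)

  deficiency≥4 : ∀ i j x → i ≢ j → size i ≡ 3 → size j ≡ 3 → x ∈ block i → x ∈ block j →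
                 4 ≤ deficiency x
  deficiency≥4 i j x i≢j ∣Bi∣≡3 ∣Bj∣≡3 x∈Bi x∈Bj =
    subst (_≤ deficiency x) (cong₂ _+_ (triangle-term i ∣Bi∣≡3 x∈Bi) (triangle-term j ∣Bj∣≡3 x∈Bj))
      (∑-≥-pair (λ l → incidence l x * (5 ∸ size l)) i j i≢j)
    where
    triangle-term : ∀ l → size l ≡ 3 → x ∈ block l → incidence l x * (5 ∸ size l) ≡ 2
    triangle-term l ∣Bl∣≡3 x∈Bl = cong₂ _*_ (χ-yes (x ∈? block l) x∈Bl) (cong (5 ∸_) ∣Bl∣≡3)

  weighted-size-count : 2 * ∑[ i < n ] ((5 ∸ size i) * size i) + ∑[ i < n ] (size i * size i)
                          + 2 * ∑[ i < n ] χ (size i ℕ.≟ 3)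
                        ≡ 20 * n + ∑[ i < n ] size i
  weighted-size-count = begin
    2 * sum a + sum b + 2 * sum c
      ≡⟨ cong₂ (λ p q → p + sum b + q) (*-distribˡ-sum 2 a) (*-distribˡ-sum 2 c) ⟩
    ∑[ i < n ] (2 * a i) + sum b + ∑[ i < n ] (2 * c i)
      ≡⟨ cong (_+ ∑[ i < n ] (2 * c i)) (∑-distrib-+ (λ i → 2 * a i) b) ⟨
    ∑[ i < n ] (2 * a i + b i) + ∑[ i < n ] (2 * c i)
      ≡⟨ ∑-distrib-+ (λ i → 2 * a i + b i) (λ i → 2 * c i) ⟨
    ∑[ i < n ] (2 * a i + b i + 2 * c i)
      ≡⟨ sum-cong-≗ (In345-identity ∘ size-345) ⟩
    ∑[ i < n ] (20 + size i)
      ≡⟨ ∑-distrib-+ (λ _ → 20) size ⟩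
    ∑[ i < n ] 20 + sum size
      ≡⟨ cong (_+ sum size) (trans (∑-const n 20) (*-comm n 20)) ⟩
    20 * n + sum size
      ∎
    where
    a b c : Fin n → ℕ
    a i = (5 ∸ size i) * size i
    b i = size i * size i
    c i = χ (size i ℕ.≟ 3)

  ∑-deficiency : numTriangles bs ≡ 7 → 20 * n ≡ v * v + 5 * v + 14 →
                 ∑[ x < v ] deficiency x ≡ v * 3
  ∑-deficiency seven-triangles clique-count =
    trans (double-counting (λ i → 5 ∸ size i))
          (total-deficiency F Q (sum size) n v count ∑-size² clique-count)
    where
    F Q : ℕ
    F = ∑[ i < n ] ((5 ∸ size i) * size i)
    Q = ∑[ i < n ] (size i * size i)
    triangles≡7 : ∑[ i < n ] χ (size i ℕ.≟ 3) ≡ 7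
    triangles≡7 = trans (sym (length-filter≡∑χ (λ b → length b ℕ.≟ 3) bs)) seven-triangles
    count : 2 * F + Q + 2 * 7 ≡ 20 * n + sum size
    count = trans (cong (λ t → 2 * F + Q + 2 * t) (sym triangles≡7)) weighted-size-count

proposition12 : (v : ℕ) → (v % 20 ≡ 6 ⊎ v % 20 ≡ 14) →
    (bs : List (Clique v)) → IsK345Decomposition v bs →
    20 * length bs ≡ v * v + 5 * v + 14 →
    numTriangles bs ≡ 7 →
    (i j : Fin (length bs)) → i ≢ j →
    length (lookup bs i) ≡ 3 → length (lookup bs j) ≡ 3 →
    (x : Fin v) → x ∈ lookup bs i → x ∉ lookup bs j
proposition12 v v-mod-20 bs dec clique-count seven-triangles i j i≢j ∣Bi∣≡3 ∣Bj∣≡3 x x∈Bi x∈Bj =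
  <-irrefl refl (subst (4 ≤_) (deficiency≡3 x) (deficiency≥4 i j x i≢j ∣Bi∣≡3 ∣Bj∣≡3 x∈Bi x∈Bj))
  where
  open K345Decomposition bs dec
  v≡2-mod-4 : ∃[ k ] v ≡ k * 4 + 2
  v≡2-mod-4 = ≡6∨14-mod-20⇒≡2-mod-4 v v-mod-20
  deficiency≡3 : ∀ y → deficiency y ≡ 3
  deficiency≡3 = ∑-≡-lower-bound⇒const deficiency 3
    (deficiency≥3 (proj₁ v≡2-mod-4) (proj₂ v≡2-mod-4))
    (∑-deficiency seven-triangles clique-count)
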